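{- There are first-order formulas $\varphi_Q(x,u)$ and $\varphi_R(x,u)$ over the vocabulary $\{<,\sqsubset,C,Q\}$ such that for every $n\in\mathbb{N}$ and all $x,u\in[n]$, in the structure $([n],<^n,\sqsubset^n,C^n,Q^n)$: $\varphi_Q(x,u)$ holds iff the $r(u)$-th bit of the binary representation of $q(x)$ is $1$, and $\varphi_R(x,u)$ holds iff the $r(u)$-th bit of the binary representation of $r(x)$ is $1$.
   Context: $\mathbb{N}=\{0,1,2,\dots\}$, $[n]=\{0,\dots,n\}$; for a relation $P$ on $\mathbb{N}$, $P^n$ is its restriction to $[n]$. Bits are numbered from the least significant bit, which is bit $0$. For $i\in\mathbb{N}$ let $q_i=i(i+1)/2$. For $x\in\mathbb{N}$ let $c(x)=\max\{i: q_i\le x\}$, $q(x)=q_{c(x)}$, $r(x)=x-q(x)$. $<$ is the usual order; $x\sqsubset y$ iff $r(x)<r(y)$, or $r(x)=r(y)$ and $c(x)<c(y)$. $C=\{x: 2\nmid\lfloor (c(x)+1)/2^{r(x)}\rfloor\}$ and $Q=\{x: 2\nmid\lfloor q_{c(x)+1}/2^{r(x)}\rfloor\}$. -}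

module Defs where

open import Data.Nat using (ℕ; zero; suc; _+_; _*_; _/_; _%_; _≤ᵇ_; _<ᵇ_; _≡ᵇ_)
open import Data.Bool using (Bool; true; false; not; _∧_; _∨_; if_then_else_)
open import Data.Fin using (Fin)
open import Data.Vec using (Vec; lookup; _∷_)
open import Data.List using (List; upTo)
open import Data.Bool.ListAction using (any)

qᵢ : ℕ → ℕ
qᵢ i = (i * suc i) / 2

-- c(x) = max { i : q_i ≤ x }  (the max lies in [x], since q_i ≥ i)
cMax : ℕ → ℕ → ℕ
cMax x zero    = zero
cMax x (suc i) = if qᵢ (suc i) ≤ᵇ x then suc i else cMax x i

c : ℕ → ℕ
c x = cMax x x

q : ℕ → ℕ
q x = qᵢ (c x)

r : ℕ → ℕ
r x = x Data.Nat.∸ q x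

bit : ℕ → ℕ → Bool
bit m zero    = (m % 2) ≡ᵇ 1
bit m (suc j) = bit (m / 2) j

ltR : ℕ → ℕ → Bool
ltR x y = x <ᵇ y

sqR : ℕ → ℕ → Bool
sqR x y = (r x <ᵇ r y) ∨ ((r x ≡ᵇ r y) ∧ (c x <ᵇ c y))

CR : ℕ → Bool
CR x = bit (suc (c x)) (r x)

QR : ℕ → Bool
QR x = bit (qᵢ (suc (c x))) (r x)

data Formula : ℕ → Set where
  _≐_  : ∀ {k} → Fin k → Fin k → Formula k
  _≺_  : ∀ {k} → Fin k → Fin k → Formula k
  _⊏_  : ∀ {k} → Fin k → Fin k → Formula k
  Cᶠ   : ∀ {k} → Fin k → Formula k
  Qᶠ   : ∀ {k} → Fin k → Formula k
  ¬ᶠ_  : ∀ {k} → Formula k → Formula k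
  _∧ᶠ_ : ∀ {k} → Formula k → Formula k → Formula k
  _∨ᶠ_ : ∀ {k} → Formula k → Formula k → Formula k
  ∃ᶠ   : ∀ {k} → Formula (suc k) → Formula k
  ∀ᶠ   : ∀ {k} → Formula (suc k) → Formula k

-- satisfaction in the structure ([n], <^n, ⊏^n, C^n, Q^n); variable 0 = most recently bound.
-- Quantifiers range over [n] = {0,…,n} = upTo (suc n).
⟦_⟧ : ∀ {k} → Formula k → (n : ℕ) → Vec ℕ k → Bool
⟦ i ≐ j ⟧ n ρ = lookup ρ i ≡ᵇ lookup ρ j
⟦ i ≺ j ⟧ n ρ = ltR (lookup ρ i) (lookup ρ j)
⟦ i ⊏ j ⟧ n ρ = sqR (lookup ρ i) (lookup ρ j)
⟦ Cᶠ i ⟧ n ρ = CR (lookup ρ i)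
⟦ Qᶠ i ⟧ n ρ = QR (lookup ρ i)
⟦ ¬ᶠ φ ⟧ n ρ = not (⟦ φ ⟧ n ρ)
⟦ φ ∧ᶠ ψ ⟧ n ρ = ⟦ φ ⟧ n ρ ∧ ⟦ ψ ⟧ n ρ
⟦ φ ∨ᶠ ψ ⟧ n ρ = ⟦ φ ⟧ n ρ ∨ ⟦ ψ ⟧ n ρ
⟦ ∃ᶠ φ ⟧ n ρ = any (λ m → ⟦ φ ⟧ n (m ∷ ρ)) (upTo (suc n))
⟦ ∀ᶠ φ ⟧ n ρ = not (any (λ m → not (⟦ φ ⟧ n (m ∷ ρ))) (upTo (suc n)))

module Submission where

open import Defs
open import Data.Nat using (ℕ; _≤_)
open import Data.Bool using (Bool; true)
open import Data.Vec using (_∷_; [])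
open import Data.Product using (Σ; _×_)
open import Relation.Binary.PropositionalEquality using (_≡_)

open import Data.Nat using (zero; suc; _+_; _*_; _∸_; _^_; _<_; z≤n; s≤s; _/_; _≤ᵇ_; _<?_; _≟_)
open import Data.Nat.Properties
open import Algebra.Properties.CommutativeSemigroup +-commutativeSemigroup using (xy∙z≈xz∙y)
open import Data.Nat.DivMod using (m*n/n≡m; m/n*n≤m)
open import Data.Bool using (T; not; false)
open import Data.Fin using (Fin) renaming (zero to fzero; suc to fsuc)
open import Data.Vec using (Vec; lookup)
open import Data.Product using (_,_; ∃-syntax)
open import Data.Sum using (_⊎_; inj₁; inj₂; [_,_])
open import Data.List using (upTo)
open import Data.List.Membership.Propositional using (find; lose)
open import Data.List.Membership.Propositional.Properties using (∈-upTo⁺; ∈-upTo⁻)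
open import Data.List.Relation.Unary.Any.Properties using (any⁺; any⁻)
open import Data.Bool.ListAction using (any)
open import Function using (_∘_; _⇔_; mk⇔; Equivalence)
open import Relation.Nullary using (¬_; yes; no; _because_; contradiction)
open import Relation.Nullary.Decidable using (decidable-stable)
open import Relation.Nullary.Reflects
  using (Reflects; ofʸ; ofⁿ; fromEquivalence; det; T-reflects; ¬-reflects; _×-reflects_; _⊎-reflects_)
open import Relation.Binary.PropositionalEquality
  using (refl; sym; trans; cong; cong₂; subst; subst₂; module ≡-Reasoning)

-- Write x = ⟨ c x , r x ⟩ = tri (c x) + r x with r x ≤ c x, so that < is the row-major and ⊏
-- the column-major order on these coordinates. The off-diagonal points are exactly those s whose
-- ⊏-predecessor p satisfies p < s and (p = 0 or s ≠ p + 1); two points lie in the same column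
-- iff they are ⊏-below the same diagonal points; and c y + 1 = c x iff exactly one row start
-- ⟨ i , 0 ⟩ lies in (y, x]. Since Q y is bit r y of q_(c y + 1), φQ(x, u) asks for a point y in Q
-- with c y + 1 = c x and r y = r u; since C z is bit r z of c z + 1, φR(x, u) asks for a point z
-- in C with r z = r u and c z + 1 = c d, d the diagonal point in the column of x. These points
-- exist whenever the bit is set, because q_i < 2^i and i < 2^i.

private variable
  i j : ℕ

m<n⇒n≡1+k×m≤k : ∀ {m n} → m < n → ∃[ k ] suc k ≡ n × m ≤ k
m<n⇒n≡1+k×m≤k (s≤s m≤k) = _ , refl , m≤k

tri : ℕ → ℕ
tri zero    = zero
tri (suc i) = tri i + suc i

tri*2 : ∀ i → tri i * 2 ≡ i * suc i
tri*2 zero    = refl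
tri*2 (suc i) = begin
  (tri i + suc i) * 2    ≡⟨ *-distribʳ-+ 2 (tri i) (suc i) ⟩
  tri i * 2 + suc i * 2  ≡⟨ cong (_+ suc i * 2) (trans (tri*2 i) (*-comm i (suc i))) ⟩
  suc i * i + suc i * 2  ≡⟨ *-distribˡ-+ (suc i) i 2 ⟨
  suc i * (i + 2)        ≡⟨ cong (suc i *_) (+-comm i 2) ⟩
  suc i * suc (suc i)    ∎
  where open ≡-Reasoning

qᵢ≡tri : ∀ i → qᵢ i ≡ tri i
qᵢ≡tri i = trans (cong (_/ 2) (sym (tri*2 i))) (m*n/n≡m (tri i) 2)

tri-mono-≤ : i ≤ j → tri i ≤ tri j
tri-mono-≤ {zero}  _           = z≤n
tri-mono-≤ {suc i} (s≤s i≤j) = +-mono-≤ (tri-mono-≤ i≤j) (s≤s i≤j)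

n≤tri : ∀ i → i ≤ tri i
n≤tri zero    = z≤n
n≤tri (suc i) = m≤n+m (suc i) (tri i)

⟨_,_⟩ : ℕ → ℕ → ℕ
⟨ i , j ⟩ = tri i + j

⟨⟩<tri-suc : j ≤ i → ⟨ i , j ⟩ < tri (suc i)
⟨⟩<tri-suc {i = i} j≤i = +-monoʳ-< (tri i) (s≤s j≤i)

cMax-tri≤ : ∀ x i → tri (cMax x i) ≤ x
cMax-tri≤ x zero = z≤n
cMax-tri≤ x (suc i) with qᵢ (suc i) ≤ᵇ x | ≤ᵇ-reflects-≤ (qᵢ (suc i)) x
... | true  | ofʸ h = subst (_≤ x) (qᵢ≡tri (suc i)) h
... | false | ofⁿ _ = cMax-tri≤ x i

cMax-maximal : ∀ x i → j ≤ i → tri j ≤ x → j ≤ cMax x i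
cMax-maximal x zero    j≤0   _ = j≤0
cMax-maximal x (suc i) j≤1+i h with qᵢ (suc i) ≤ᵇ x | ≤ᵇ-reflects-≤ (qᵢ (suc i)) x
... | true  | _     = j≤1+i
... | false | ofⁿ ¬h with m≤n⇒m<n∨m≡n j≤1+i
...   | inj₁ j<1+i = cMax-maximal x i (≤-pred j<1+i) h
...   | inj₂ refl  = contradiction (subst (_≤ x) (sym (qᵢ≡tri (suc i))) h) ¬h

tri-c≤ : ∀ x → tri (c x) ≤ x
tri-c≤ x = cMax-tri≤ x x

<tri-suc-c : ∀ x → x < tri (suc (c x))
<tri-suc-c x with tri (suc (c x)) ≤? x
... | yes h = contradiction (cMax-maximal x x (≤-trans (n≤tri _) h) h) 1+n≰n
... | no ¬h = ≰⇒> ¬h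

tri≤⇒≤c : ∀ {x} → tri i ≤ x → i ≤ c x
tri≤⇒≤c {x = x} h = ≮⇒≥ λ cx<i → <⇒≱ (<tri-suc-c x) (≤-trans (tri-mono-≤ cx<i) h)

≤c⇒tri≤ : ∀ {x} → i ≤ c x → tri i ≤ x
≤c⇒tri≤ {x = x} i≤cx = ≤-trans (tri-mono-≤ i≤cx) (tri-c≤ x)

<tri⇒c< : ∀ {x} → x < tri i → c x < i
<tri⇒c< x<tri = ≰⇒> λ i≤cx → <⇒≱ x<tri (≤c⇒tri≤ i≤cx)

c-mono-≤ : ∀ {x y} → x ≤ y → c x ≤ c y
c-mono-≤ {x} x≤y = tri≤⇒≤c (≤-trans (tri-c≤ x) x≤y)

c<⇒<tri : ∀ {x} → c x < i → x < tri i
c<⇒<tri {x = x} cx<i = <-≤-trans (<tri-suc-c x) (tri-mono-≤ cx<i)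

c<⇒< : ∀ {x y} → c x < c y → x < y
c<⇒< {x} {y} cx<cy = <-≤-trans (c<⇒<tri cx<cy) (tri-c≤ y)

c-⟨⟩ : j ≤ i → c ⟨ i , j ⟩ ≡ i
c-⟨⟩ {j} {i} j≤i = ≤-antisym (≤-pred (<tri⇒c< (⟨⟩<tri-suc j≤i))) (tri≤⇒≤c (m≤m+n (tri i) j))

r-⟨⟩ : j ≤ i → r ⟨ i , j ⟩ ≡ j
r-⟨⟩ {j} {i} j≤i = begin
  ⟨ i , j ⟩ ∸ qᵢ (c ⟨ i , j ⟩)  ≡⟨ cong (⟨ i , j ⟩ ∸_) (qᵢ≡tri (c ⟨ i , j ⟩)) ⟩
  ⟨ i , j ⟩ ∸ tri (c ⟨ i , j ⟩) ≡⟨ cong (λ k → ⟨ i , j ⟩ ∸ tri k) (c-⟨⟩ j≤i) ⟩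
  tri i + j ∸ tri i             ≡⟨ m+n∸m≡n (tri i) j ⟩
  j                             ∎
  where open ≡-Reasoning

⟨c,r⟩≡ : ∀ x → ⟨ c x , r x ⟩ ≡ x
⟨c,r⟩≡ x = begin
  tri (c x) + (x ∸ qᵢ (c x))  ≡⟨ cong (λ k → tri (c x) + (x ∸ k)) (qᵢ≡tri (c x)) ⟩
  tri (c x) + (x ∸ tri (c x)) ≡⟨ m+[n∸m]≡n (tri-c≤ x) ⟩
  x                           ∎
  where open ≡-Reasoning

r≤c : ∀ x → r x ≤ c x
r≤c x = ≤-pred (+-cancelˡ-< (tri (c x)) _ _
  (subst (_< tri (suc (c x))) (sym (⟨c,r⟩≡ x)) (<tri-suc-c x)))

c,r-injective : ∀ {x y} → c x ≡ c y → r x ≡ r y → x ≡ y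
c,r-injective {x} {y} cx≡cy rx≡ry =
  trans (sym (⟨c,r⟩≡ x)) (trans (cong₂ ⟨_,_⟩ cx≡cy rx≡ry) (⟨c,r⟩≡ y))

⟨⟩<-of-row< : ∀ {x} → j ≤ i → i < c x → ⟨ i , j ⟩ < x
⟨⟩<-of-row< j≤i i<cx = c<⇒< (subst (_< _) (sym (c-⟨⟩ j≤i)) i<cx)

diagonal≤ : ∀ x → ⟨ r x , r x ⟩ ≤ x
diagonal≤ x = ≤-trans (+-monoˡ-≤ (r x) (tri-mono-≤ (r≤c x))) (≤-reflexive (⟨c,r⟩≡ x))

⟨⟩≡0⊎1+⟨⟩<⟨suc⟩ : j ≤ i → ⟨ i , j ⟩ ≡ 0 ⊎ suc ⟨ i , j ⟩ < ⟨ suc i , j ⟩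
⟨⟩≡0⊎1+⟨⟩<⟨suc⟩ {i = zero}  z≤n = inj₁ refl
⟨⟩≡0⊎1+⟨⟩<⟨suc⟩ {j} {suc i} _   =
  inj₂ (subst₂ _<_ (+-comm p 1) (sym below≡) (+-monoʳ-< p (s≤s (s≤s z≤n))))
  where
  p : ℕ
  p = ⟨ suc i , j ⟩
  below≡ : ⟨ suc (suc i) , j ⟩ ≡ p + suc (suc i)
  below≡ = xy∙z≈xz∙y (tri (suc i)) (suc (suc i)) j

c-tri : ∀ i → c (tri i) ≡ i
c-tri i = subst (λ t → c t ≡ i) (+-identityʳ (tri i)) (c-⟨⟩ z≤n)

r-tri : ∀ i → r (tri i) ≡ 0
r-tri i = subst (λ t → r t ≡ 0) (+-identityʳ (tri i)) (r-⟨⟩ {i = i} z≤n)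

tri-c≡ : ∀ {x} → r x ≡ 0 → tri (c x) ≡ x
tri-c≡ {x} rx≡0 = trans (sym (+-identityʳ _)) (trans (cong (tri (c x) +_) (sym rx≡0)) (⟨c,r⟩≡ x))

<rowStart⇔c< : ∀ {y s} → r s ≡ 0 → y < s ⇔ c y < c s
<rowStart⇔c< {y} {s} rs≡0 =
  mk⇔ (<tri⇒c< ∘ subst (y <_) (sym (tri-c≡ rs≡0))) (subst (y <_) (tri-c≡ rs≡0) ∘ c<⇒<tri)

rowStart≤⇔c≤ : ∀ {x s} → r s ≡ 0 → s ≤ x ⇔ c s ≤ c x
rowStart≤⇔c≤ {x} {s} rs≡0 =
  mk⇔ (tri≤⇒≤c ∘ subst (_≤ x) (sym (tri-c≡ rs≡0))) (subst (_≤ x) (tri-c≡ rs≡0) ∘ ≤c⇒tri≤)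

bit⇒2^≤ : ∀ m j → T (bit m j) → 2 ^ j ≤ m
bit⇒2^≤ zero    zero    ()
bit⇒2^≤ (suc m) zero    _ = s≤s z≤n
bit⇒2^≤ m       (suc j) h = begin
  2 * 2 ^ j    ≤⟨ *-monoʳ-≤ 2 (bit⇒2^≤ (m / 2) j h) ⟩
  2 * (m / 2)  ≡⟨ *-comm 2 (m / 2) ⟩
  m / 2 * 2    ≤⟨ m/n*n≤m m 2 ⟩
  m            ∎
  where open ≤-Reasoning

bit⇒index< : ∀ {m j i} → T (bit m j) → m < 2 ^ i → j < i
bit⇒index< {m} {j} h m<2^i = ≰⇒> λ i≤j → <⇒≱ m<2^i (≤-trans (^-monoʳ-≤ 2 i≤j) (bit⇒2^≤ m j h))

tri<2^ : ∀ i → tri i < 2 ^ i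
tri<2^ zero    = s≤s z≤n
tri<2^ (suc i) = begin-strict
  tri i + suc i      <⟨ +-mono-<-≤ (tri<2^ i) (≤-<-trans (n≤tri i) (tri<2^ i)) ⟩
  2 ^ i + 2 ^ i      ≡⟨ cong (2 ^ i +_) (+-identityʳ (2 ^ i)) ⟨
  2 ^ suc i          ∎
  where open ≤-Reasoning

infix 4 _⊏ₙ_

_⊏ₙ_ : ℕ → ℕ → Set
x ⊏ₙ y = r x < r y ⊎ (r x ≡ r y × c x < c y)

⊏ₙ⇒r≤ : ∀ x y → x ⊏ₙ y → r x ≤ r y
⊏ₙ⇒r≤ x y (inj₁ rx<ry)       = <⇒≤ rx<ry
⊏ₙ⇒r≤ x y (inj₂ (rx≡ry , _)) = ≤-reflexive rx≡ry

⊏ₙ-sameColumn : ∀ x y → x ⊏ₙ y → r x ≡ r y → c x < c y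
⊏ₙ-sameColumn x y (inj₁ rx<ry)       rx≡ry = contradiction rx≡ry (<⇒≢ rx<ry)
⊏ₙ-sameColumn x y (inj₂ (_ , cx<cy)) _     = cx<cy

⊏ₙ-diagonal : ∀ x y → r y ≡ c y → x ⊏ₙ y ⇔ r x < r y
⊏ₙ-diagonal x y diag = mk⇔ to inj₁
  where
  to : x ⊏ₙ y → r x < r y
  to (inj₁ rx<ry)            = rx<ry
  to (inj₂ (rx≡ry , cx<cy)) =
    contradiction (≤-<-trans (subst (_≤ c x) (trans rx≡ry diag) (r≤c x)) cx<cy) (n≮n (c y))

Sat : ∀ {k} → Formula k → ℕ → Vec ℕ k → Set
Sat (i ≐ j)    n ρ = lookup ρ i ≡ lookup ρ j
Sat (i ≺ j)    n ρ = lookup ρ i < lookup ρ j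
Sat (i ⊏ j)    n ρ = lookup ρ i ⊏ₙ lookup ρ j
Sat (Cᶠ i)     n ρ = T (CR (lookup ρ i))
Sat (Qᶠ i)     n ρ = T (QR (lookup ρ i))
Sat (¬ᶠ φ)     n ρ = ¬ Sat φ n ρ
Sat (φ ∧ᶠ ψ)   n ρ = Sat φ n ρ × Sat ψ n ρ
Sat (φ ∨ᶠ ψ)   n ρ = Sat φ n ρ ⊎ Sat ψ n ρ
Sat (∃ᶠ φ)     n ρ = ∃[ m ] m ≤ n × Sat φ n (m ∷ ρ)
Sat (∀ᶠ φ)     n ρ = ∀ m → m ≤ n → Sat φ n (m ∷ ρ)

map-reflects : ∀ {A B : Set} {b} → (A → B) → (B → A) → Reflects A b → Reflects B b
map-reflects f g (ofʸ a)  = ofʸ (f a)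
map-reflects f g (ofⁿ ¬a) = ofⁿ (¬a ∘ g)

reflects⇒T⇔ : ∀ {A : Set} {b} → Reflects A b → T b ⇔ A
reflects⇒T⇔ (ofʸ a)  = mk⇔ (λ _ → a) _
reflects⇒T⇔ (ofⁿ ¬a) = mk⇔ (λ ()) ¬a

any-upTo-reflects : ∀ {P : ℕ → Set} {f : ℕ → Bool} → (∀ m → Reflects (P m) (f m)) →
                    ∀ n → Reflects (∃[ m ] m ≤ n × P m) (any f (upTo (suc n)))
any-upTo-reflects {P} {f} P-reflects n = fromEquivalence sound complete
  where
  sound : T (any f (upTo (suc n))) → ∃[ m ] m ≤ n × P m
  sound t with m , m∈ , fm ← find (any⁻ f _ t) =
    m , ≤-pred (∈-upTo⁻ m∈) , Equivalence.to (reflects⇒T⇔ (P-reflects m)) fm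
  complete : ∃[ m ] m ≤ n × P m → T (any f (upTo (suc n)))
  complete (m , m≤n , pm) =
    any⁺ f (lose (∈-upTo⁺ (s≤s m≤n)) (Equivalence.from (reflects⇒T⇔ (P-reflects m)) pm))

all-upTo-reflects : ∀ {P : ℕ → Set} {f : ℕ → Bool} → (∀ m → Reflects (P m) (f m)) →
                    ∀ n → Reflects (∀ m → m ≤ n → P m) (not (any (not ∘ f) (upTo (suc n))))
all-upTo-reflects {P} {f} P-reflects n =
  map-reflects noCounterexample⇒all all⇒noCounterexample
    (¬-reflects (any-upTo-reflects (¬-reflects ∘ P-reflects) n))
  where
  noCounterexample⇒all : ¬ (∃[ m ] m ≤ n × ¬ P m) → ∀ m → m ≤ n → P m
  noCounterexample⇒all none m m≤n =
    decidable-stable (f m because P-reflects m) (λ ¬pm → none (m , m≤n , ¬pm))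
  all⇒noCounterexample : (∀ m → m ≤ n → P m) → ¬ (∃[ m ] m ≤ n × ¬ P m)
  all⇒noCounterexample all (m , m≤n , ¬pm) = ¬pm (all m m≤n)

Sat-reflects : ∀ {k} (φ : Formula k) n ρ → Reflects (Sat φ n ρ) (⟦ φ ⟧ n ρ)
Sat-reflects (i ≐ j)  n ρ = fromEquivalence (≡ᵇ⇒≡ _ _) (≡⇒≡ᵇ _ _)
Sat-reflects (i ≺ j)  n ρ = <ᵇ-reflects-< _ _
Sat-reflects (i ⊏ j)  n ρ =
  <ᵇ-reflects-< _ _ ⊎-reflects (fromEquivalence (≡ᵇ⇒≡ _ _) (≡⇒≡ᵇ _ _) ×-reflects <ᵇ-reflects-< _ _)
Sat-reflects (Cᶠ i)   n ρ = T-reflects _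
Sat-reflects (Qᶠ i)   n ρ = T-reflects _
Sat-reflects (¬ᶠ φ)   n ρ = ¬-reflects (Sat-reflects φ n ρ)
Sat-reflects (φ ∧ᶠ ψ) n ρ = Sat-reflects φ n ρ ×-reflects Sat-reflects ψ n ρ
Sat-reflects (φ ∨ᶠ ψ) n ρ = Sat-reflects φ n ρ ⊎-reflects Sat-reflects ψ n ρ
Sat-reflects (∃ᶠ φ)   n ρ = any-upTo-reflects (λ m → Sat-reflects φ n (m ∷ ρ)) n
Sat-reflects (∀ᶠ φ)   n ρ = all-upTo-reflects (λ m → Sat-reflects φ n (m ∷ ρ)) n

isZeroᶠ : ∀ {k} → Fin k → Formula k
isZeroᶠ p = ∀ᶠ (¬ᶠ (fzero ≺ fsuc p))

isZero-sound : ∀ {k} (p : Fin k) n ρ → Sat (isZeroᶠ p) n ρ → lookup ρ p ≡ 0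
isZero-sound p n ρ nothing-below = n≤0⇒n≡0 (≮⇒≥ (nothing-below 0 z≤n))

isZero-complete : ∀ {k} (p : Fin k) n ρ → lookup ρ p ≡ 0 → Sat (isZeroᶠ p) n ρ
isZero-complete p n ρ p≡0 m _ m<p = n≮0 (subst (m <_) p≡0 m<p)

⊏-predᶠ : ∀ {k} → Fin k → Fin k → Formula k
⊏-predᶠ p s = (p ⊏ s) ∧ᶠ ∀ᶠ (¬ᶠ ((fsuc p ⊏ fzero) ∧ᶠ (fzero ⊏ fsuc s)))

offDiagonalᶠ : ∀ {k} → Fin k → Formula k
offDiagonalᶠ s = ∃ᶠ (⊏-predᶠ fzero (fsuc s) ∧ᶠ ((fzero ≺ fsuc s) ∧ᶠ
  (isZeroᶠ fzero ∨ᶠ ∃ᶠ ((fsuc fzero ≺ fzero) ∧ᶠ (fzero ≺ fsuc (fsuc s))))))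

⊏-pred-of-diagonal : ∀ {n s p} → s ≤ n → r s ≡ c s → p ⊏ₙ s → p < s →
                     (∀ z → z ≤ n → ¬ (p ⊏ₙ z × z ⊏ₙ s)) → suc p ≡ s
⊏-pred-of-diagonal {n} {s} {p} s≤n diag p⊏s p<s adjacent
  -- t = ⟨ c s , r s - 1 ⟩ = s - 1 lies ⊏-below s, so adjacency forces t ⊑ p, and p < s pins p = t
  with k , 1+k≡rs , rp≤k ← m<n⇒n≡1+k×m≤k (Equivalence.to (⊏ₙ-diagonal p s diag) p⊏s)
  = trans (cong suc p≡t) 1+t≡s
  where
  k≤cs : k ≤ c s
  k≤cs = ≤-trans (n≤1+n k) (≤-trans (≤-reflexive 1+k≡rs) (r≤c s))
  t : ℕ
  t = ⟨ c s , k ⟩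
  1+t≡s : suc t ≡ s
  1+t≡s = trans (sym (+-suc (tri (c s)) k)) (trans (cong (tri (c s) +_) 1+k≡rs) (⟨c,r⟩≡ s))
  t⊏s : t ⊏ₙ s
  t⊏s = inj₁ (subst₂ _<_ (sym (r-⟨⟩ k≤cs)) 1+k≡rs (n<1+n k))
  ¬p⊏t : ¬ p ⊏ₙ t
  ¬p⊏t p⊏t = adjacent t (≤-trans (n≤1+n t) (subst (_≤ n) (sym 1+t≡s) s≤n)) (p⊏t , t⊏s)
  rp≡rt : r p ≡ r t
  rp≡rt = ≤-antisym (subst (r p ≤_) (sym (r-⟨⟩ k≤cs)) rp≤k) (≮⇒≥ (¬p⊏t ∘ inj₁))
  cp≡ct : c p ≡ c t
  cp≡ct = ≤-antisym (subst (c p ≤_) (sym (c-⟨⟩ k≤cs)) (c-mono-≤ (<⇒≤ p<s)))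
                    (≮⇒≥ λ cp<ct → ¬p⊏t (inj₂ (rp≡rt , cp<ct)))
  p≡t : p ≡ t
  p≡t = c,r-injective cp≡ct rp≡rt

offDiagonal-sound : ∀ {k} (s : Fin k) n ρ → lookup ρ s ≤ n → Sat (offDiagonalᶠ s) n ρ →
                    r (lookup ρ s) < c (lookup ρ s)
offDiagonal-sound s n ρ s≤n (p , _ , (p⊏s , adjacent) , p<s , p≡0∨gap) =
  ≤∧≢⇒< (r≤c (lookup ρ s)) λ diag → [ p≢0 diag , no-gap diag ] p≡0∨gap
  where
  1+p≡s : r (lookup ρ s) ≡ c (lookup ρ s) → suc p ≡ lookup ρ s
  1+p≡s diag = ⊏-pred-of-diagonal s≤n diag p⊏s p<s adjacent
  p≢0 : r (lookup ρ s) ≡ c (lookup ρ s) → ¬ Sat (isZeroᶠ fzero) n (p ∷ ρ)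
  -- p = 0 would make s = 1 = ⟨ 1 , 0 ⟩, which is off the diagonal
  p≢0 diag p≡0 with () ← subst (λ x → r x ≡ c x)
    (trans (sym (1+p≡s diag)) (cong suc (isZero-sound fzero n (p ∷ ρ) p≡0))) diag
  no-gap : r (lookup ρ s) ≡ c (lookup ρ s) → ¬ (∃[ z ] z ≤ n × (p < z × z < lookup ρ s))
  no-gap diag (z , _ , p<z , z<s) = <⇒≱ p<z (≤-pred (subst (z <_) (sym (1+p≡s diag)) z<s))

offDiagonal-complete : ∀ {k} (s : Fin k) n ρ → lookup ρ s ≤ n → r (lookup ρ s) < c (lookup ρ s) →
                       Sat (offDiagonalᶠ s) n ρ
offDiagonal-complete s n ρ s≤n rv<cv with m<n⇒n≡1+k×m≤k rv<cv
... | k , 1+k≡cv , rv≤k = p , ≤-trans (<⇒≤ p<v) s≤n , (p⊏v , adjacent) , p<v , p≡0∨gap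
  where
  v : ℕ
  v = lookup ρ s
  p : ℕ
  p = ⟨ k , r v ⟩
  rp≡rv : r p ≡ r v
  rp≡rv = r-⟨⟩ rv≤k
  1+cp≡cv : suc (c p) ≡ c v
  1+cp≡cv = trans (cong suc (c-⟨⟩ rv≤k)) 1+k≡cv
  p<v : p < v
  p<v = c<⇒< (subst (c p <_) 1+cp≡cv (n<1+n (c p)))
  p⊏v : p ⊏ₙ v
  p⊏v = inj₂ (rp≡rv , subst (c p <_) 1+cp≡cv (n<1+n (c p)))
  adjacent : ∀ z → z ≤ n → ¬ (p ⊏ₙ z × z ⊏ₙ v)
  adjacent z _ (p⊏z , z⊏v) = <⇒≱ (⊏ₙ-sameColumn p z p⊏z (trans rp≡rv (sym rz≡rv)))
                                  (≤-pred (subst (c z <_) (sym 1+cp≡cv) (⊏ₙ-sameColumn z v z⊏v rz≡rv)))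
    where
    rz≡rv : r z ≡ r v
    rz≡rv = ≤-antisym (⊏ₙ⇒r≤ z v z⊏v) (subst (_≤ r z) rp≡rv (⊏ₙ⇒r≤ p z p⊏z))
  v≡ : ⟨ suc k , r v ⟩ ≡ v
  v≡ = trans (cong (λ i → ⟨ i , r v ⟩) 1+k≡cv) (⟨c,r⟩≡ v)
  p≡0∨gap : Sat (isZeroᶠ fzero) n (p ∷ ρ) ⊎ (∃[ z ] z ≤ n × (p < z × z < v))
  p≡0∨gap with ⟨⟩≡0⊎1+⟨⟩<⟨suc⟩ rv≤k
  ... | inj₁ p≡0    = inj₁ (isZero-complete fzero n (p ∷ ρ) p≡0)
  ... | inj₂ 1+p<v′ = inj₂ (suc p , ≤-trans (<⇒≤ 1+p<v) s≤n , n<1+n p , 1+p<v)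
    where
    1+p<v : suc p < v
    1+p<v = subst (suc p <_) v≡ 1+p<v′

_⇔ᶠ_ : ∀ {k} → Formula k → Formula k → Formula k
φ ⇔ᶠ ψ = (φ ∧ᶠ ψ) ∨ᶠ ((¬ᶠ φ) ∧ᶠ (¬ᶠ ψ))

sameColumnᶠ : ∀ {k} → Fin k → Fin k → Formula k
sameColumnᶠ a b = ∀ᶠ (((fsuc a ⊏ fzero) ⇔ᶠ (fsuc b ⊏ fzero)) ∨ᶠ offDiagonalᶠ fzero)

sameColumn-complete : ∀ {k} (a b : Fin k) n ρ → r (lookup ρ a) ≡ r (lookup ρ b) →
                      Sat (sameColumnᶠ a b) n ρ
sameColumn-complete a b n ρ ra≡rb m m≤n with r m <? c m
... | yes rm<cm = inj₂ (offDiagonal-complete fzero n (m ∷ ρ) m≤n rm<cm)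
... | no  rm≮cm with r (lookup ρ a) <? r m
...   | yes ra<rm = inj₁ (inj₁ (inj₁ ra<rm , inj₁ (subst (_< r m) ra≡rb ra<rm)))
...   | no  ra≮rm = inj₁ (inj₂ (ra≮rm ∘ below (lookup ρ a) ,
                                ra≮rm ∘ subst (_< r m) (sym ra≡rb) ∘ below (lookup ρ b)))
  where
  below : ∀ x → x ⊏ₙ m → r x < r m
  below x = Equivalence.to (⊏ₙ-diagonal x m (≤-antisym (r≤c m) (≮⇒≥ rm≮cm)))

r≤-of-diagonals : ∀ n x y → x ≤ n →
                  (∀ d → d ≤ n → r d ≡ c d → r y < r d → r x < r d) → r x ≤ r y
r≤-of-diagonals n x y x≤n below = ≮⇒≥ λ ry<rx →
  n≮n (r x) (subst (r x <_) rd≡rx (below d d≤n diag (subst (r y <_) (sym rd≡rx) ry<rx)))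
  where
  d : ℕ
  d = ⟨ r x , r x ⟩
  d≤n : d ≤ n
  d≤n = ≤-trans (diagonal≤ x) x≤n
  rd≡rx : r d ≡ r x
  rd≡rx = r-⟨⟩ ≤-refl
  diag : r d ≡ c d
  diag = trans rd≡rx (sym (c-⟨⟩ ≤-refl))

sameColumn-sound : ∀ {k} (a b : Fin k) n ρ → lookup ρ a ≤ n → lookup ρ b ≤ n →
                   Sat (sameColumnᶠ a b) n ρ → r (lookup ρ a) ≡ r (lookup ρ b)
sameColumn-sound a b n ρ a≤n b≤n same =
  ≤-antisym (r≤-of-diagonals n (lookup ρ a) (lookup ρ b) a≤n λ d d≤n diag → Equivalence.from (agree d d≤n diag))
            (r≤-of-diagonals n (lookup ρ b) (lookup ρ a) b≤n λ d d≤n diag → Equivalence.to (agree d d≤n diag))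
  where
  agree : ∀ d → d ≤ n → r d ≡ c d → r (lookup ρ a) < r d ⇔ r (lookup ρ b) < r d
  agree d d≤n diag with same d d≤n
  ... | inj₁ (inj₁ (a⊏d , b⊏d)) = mk⇔ (λ _ → Equivalence.to (⊏ₙ-diagonal (lookup ρ b) d diag) b⊏d)
                                       (λ _ → Equivalence.to (⊏ₙ-diagonal (lookup ρ a) d diag) a⊏d)
  ... | inj₁ (inj₂ (a⋢d , b⋢d)) = mk⇔ (λ ra<rd → contradiction (inj₁ ra<rd) a⋢d)
                                       (λ rb<rd → contradiction (inj₁ rb<rd) b⋢d)
  ... | inj₂ off = contradiction diag (<⇒≢ (offDiagonal-sound fzero n (d ∷ ρ) d≤n off))

rowStartᶠ : ∀ {k} → Fin k → Formula k
rowStartᶠ t = ∃ᶠ (isZeroᶠ fzero ∧ᶠ sameColumnᶠ (fsuc t) fzero)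

rowStart-sound : ∀ {k} (t : Fin k) n ρ → lookup ρ t ≤ n → Sat (rowStartᶠ t) n ρ → r (lookup ρ t) ≡ 0
rowStart-sound t n ρ t≤n (o , o≤n , o≡0 , same) =
  trans (sameColumn-sound (fsuc t) fzero n (o ∷ ρ) t≤n o≤n same)
        (cong r (isZero-sound fzero n (o ∷ ρ) o≡0))

rowStart-complete : ∀ {k} (t : Fin k) n ρ → r (lookup ρ t) ≡ 0 → Sat (rowStartᶠ t) n ρ
rowStart-complete t n ρ rt≡0 =
  0 , z≤n , isZero-complete fzero n (0 ∷ ρ) refl , sameColumn-complete (fsuc t) fzero n (0 ∷ ρ) rt≡0

rowStartInᶠ : ∀ {k} → Fin k → Fin k → Fin k → Formula k
rowStartInᶠ y x s = rowStartᶠ s ∧ᶠ ((y ≺ s) ∧ᶠ (¬ᶠ (x ≺ s)))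

RowStartIn : ℕ → ℕ → ℕ → Set
RowStartIn y x s = r s ≡ 0 × c y < c s × c s ≤ c x

rowStartIn-sem : ∀ {k} (y x s : Fin k) n ρ → lookup ρ s ≤ n →
                 Sat (rowStartInᶠ y x s) n ρ ⇔ RowStartIn (lookup ρ y) (lookup ρ x) (lookup ρ s)
rowStartIn-sem y x s n ρ s≤n = mk⇔ to from
  where
  to : Sat (rowStartInᶠ y x s) n ρ → RowStartIn (lookup ρ y) (lookup ρ x) (lookup ρ s)
  to (start , y<s , x≮s) =
    rs≡0 , Equivalence.to (<rowStart⇔c< rs≡0) y<s , Equivalence.to (rowStart≤⇔c≤ rs≡0) (≮⇒≥ x≮s)
    where
    rs≡0 : r (lookup ρ s) ≡ 0
    rs≡0 = rowStart-sound s n ρ s≤n start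
  from : RowStartIn (lookup ρ y) (lookup ρ x) (lookup ρ s) → Sat (rowStartInᶠ y x s) n ρ
  from (rs≡0 , cy<cs , cs≤cx) = rowStart-complete s n ρ rs≡0 ,
    Equivalence.from (<rowStart⇔c< rs≡0) cy<cs , ≤⇒≯ (Equivalence.from (rowStart≤⇔c≤ rs≡0) cs≤cx)

nextRowᶠ : ∀ {k} → Fin k → Fin k → Formula k
nextRowᶠ y x = ∃ᶠ (rowStartInᶠ (fsuc y) (fsuc x) fzero ∧ᶠ
  ∀ᶠ ((¬ᶠ rowStartInᶠ (fsuc (fsuc y)) (fsuc (fsuc x)) fzero) ∨ᶠ (fzero ≐ fsuc fzero)))

nextRow-sound : ∀ {k} (y x : Fin k) n ρ → lookup ρ x ≤ n → Sat (nextRowᶠ y x) n ρ →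
                suc (c (lookup ρ y)) ≡ c (lookup ρ x)
nextRow-sound y x n ρ x≤n (s , s≤n , s-in , unique) =
  trans (row≡cs (suc (c (lookup ρ y))) ≤-refl cy<cx) (sym (row≡cs (c (lookup ρ x)) cy<cx ≤-refl))
  where
  cy<cx : c (lookup ρ y) < c (lookup ρ x)
  cy<cx with _ , cy<cs , cs≤cx ← Equivalence.to (rowStartIn-sem (fsuc y) (fsuc x) fzero n (s ∷ ρ) s≤n) s-in =
    <-≤-trans cy<cs cs≤cx
  tri≤n : ∀ {i} → i ≤ c (lookup ρ x) → tri i ≤ n
  tri≤n i≤cx = ≤-trans (≤c⇒tri≤ i≤cx) x≤n
  row≡cs : ∀ i → c (lookup ρ y) < i → i ≤ c (lookup ρ x) → i ≡ c s
  row≡cs i cy<i i≤cx with unique (tri i) (tri≤n i≤cx)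
  ... | inj₂ ti≡s = trans (sym (c-tri i)) (cong c ti≡s)
  ... | inj₁ ti∉  = contradiction
    (Equivalence.from (rowStartIn-sem (fsuc (fsuc y)) (fsuc (fsuc x)) fzero n (tri i ∷ s ∷ ρ) (tri≤n i≤cx))
      (r-tri i , subst (c (lookup ρ y) <_) (sym (c-tri i)) cy<i , subst (_≤ c (lookup ρ x)) (sym (c-tri i)) i≤cx))
    ti∉

nextRow-complete : ∀ {k} (y x : Fin k) n ρ → lookup ρ x ≤ n → suc (c (lookup ρ y)) ≡ c (lookup ρ x) →
                   Sat (nextRowᶠ y x) n ρ
nextRow-complete y x n ρ x≤n 1+cy≡cx = s , s≤n , s-in , unique
  where
  s : ℕ
  s = tri (c (lookup ρ x))
  s≤n : s ≤ n
  s≤n = ≤-trans (tri-c≤ (lookup ρ x)) x≤n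
  cs≡cx : c s ≡ c (lookup ρ x)
  cs≡cx = c-tri (c (lookup ρ x))
  s-in : Sat (rowStartInᶠ (fsuc y) (fsuc x) fzero) n (s ∷ ρ)
  s-in = Equivalence.from (rowStartIn-sem (fsuc y) (fsuc x) fzero n (s ∷ ρ) s≤n)
    (r-tri (c (lookup ρ x)) , subst (c (lookup ρ y) <_) (trans 1+cy≡cx (sym cs≡cx)) (n<1+n _) , ≤-reflexive cs≡cx)
  unique : ∀ t → t ≤ n → ¬ Sat (rowStartInᶠ (fsuc (fsuc y)) (fsuc (fsuc x)) fzero) n (t ∷ s ∷ ρ) ⊎ t ≡ s
  unique t t≤n with t ≟ s
  ... | yes t≡s = inj₂ t≡s
  ... | no  t≢s = inj₁ λ t-in →
    let rt≡0 , cy<ct , ct≤cx =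
          Equivalence.to (rowStartIn-sem (fsuc (fsuc y)) (fsuc (fsuc x)) fzero n (t ∷ s ∷ ρ) t≤n) t-in
    in t≢s (c,r-injective (trans (≤-antisym ct≤cx (subst (_≤ c t) 1+cy≡cx cy<ct)) (sym cs≡cx))
                          (trans rt≡0 (sym (r-tri (c (lookup ρ x))))))

φQ : Formula 2
φQ = ∃ᶠ (sameColumnᶠ fzero (fsuc (fsuc fzero)) ∧ᶠ (nextRowᶠ fzero (fsuc fzero) ∧ᶠ Qᶠ fzero))

φQ-sem : ∀ {n x u} → x ≤ n → u ≤ n → Sat φQ n (x ∷ u ∷ []) ⇔ T (bit (q x) (r u))
φQ-sem {n} {x} {u} x≤n u≤n = mk⇔ to from
  where
  to : Sat φQ n (x ∷ u ∷ []) → T (bit (q x) (r u))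
  to (y , y≤n , same , next , Qy) =
    subst₂ (λ i j → T (bit (qᵢ i) j)) (nextRow-sound fzero (fsuc fzero) n (y ∷ x ∷ u ∷ []) x≤n next)
      (sameColumn-sound fzero (fsuc (fsuc fzero)) n (y ∷ x ∷ u ∷ []) y≤n u≤n same) Qy
  from : T (bit (q x) (r u)) → Sat φQ n (x ∷ u ∷ [])
  from h with m<n⇒n≡1+k×m≤k (bit⇒index< h (subst (_< 2 ^ c x) (sym (qᵢ≡tri (c x))) (tri<2^ (c x))))
  ... | k , 1+k≡cx , ru≤k =
    y , ≤-trans (<⇒≤ (⟨⟩<-of-row< ru≤k (subst (k <_) 1+k≡cx (n<1+n k)))) x≤n ,
    sameColumn-complete fzero (fsuc (fsuc fzero)) n (y ∷ x ∷ u ∷ []) ry≡ru ,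
    nextRow-complete fzero (fsuc fzero) n (y ∷ x ∷ u ∷ []) x≤n 1+cy≡cx ,
    subst₂ (λ i j → T (bit (qᵢ i) j)) (sym 1+cy≡cx) (sym ry≡ru) h
    where
    y : ℕ
    y = ⟨ k , r u ⟩
    ry≡ru : r y ≡ r u
    ry≡ru = r-⟨⟩ ru≤k
    1+cy≡cx : suc (c y) ≡ c x
    1+cy≡cx = trans (cong suc (c-⟨⟩ ru≤k)) 1+k≡cx

φR : Formula 2
φR = ∃ᶠ (sameColumnᶠ fzero (fsuc fzero) ∧ᶠ ((¬ᶠ offDiagonalᶠ fzero) ∧ᶠ
       ∃ᶠ (sameColumnᶠ fzero (fsuc (fsuc (fsuc fzero))) ∧ᶠ (nextRowᶠ fzero (fsuc fzero) ∧ᶠ Cᶠ fzero))))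

φR-sem : ∀ {n x u} → x ≤ n → u ≤ n → Sat φR n (x ∷ u ∷ []) ⇔ T (bit (r x) (r u))
φR-sem {n} {x} {u} x≤n u≤n = mk⇔ to from
  where
  to : Sat φR n (x ∷ u ∷ []) → T (bit (r x) (r u))
  to (d , d≤n , sameD , onDiagonal , z , z≤n′ , sameZ , next , Cz) =
    subst₂ (λ i j → T (bit i j)) (trans 1+cz≡cd (trans (sym diag) rd≡rx)) rz≡ru Cz
    where
    rd≡rx : r d ≡ r x
    rd≡rx = sameColumn-sound fzero (fsuc fzero) n (d ∷ x ∷ u ∷ []) d≤n x≤n sameD
    diag : r d ≡ c d
    diag = ≤-antisym (r≤c d) (≮⇒≥ (onDiagonal ∘ offDiagonal-complete fzero n (d ∷ x ∷ u ∷ []) d≤n))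
    1+cz≡cd : suc (c z) ≡ c d
    1+cz≡cd = nextRow-sound fzero (fsuc fzero) n (z ∷ d ∷ x ∷ u ∷ []) d≤n next
    rz≡ru : r z ≡ r u
    rz≡ru = sameColumn-sound fzero (fsuc (fsuc (fsuc fzero))) n (z ∷ d ∷ x ∷ u ∷ []) z≤n′ u≤n sameZ
  from : T (bit (r x) (r u)) → Sat φR n (x ∷ u ∷ [])
  from h with m<n⇒n≡1+k×m≤k (bit⇒index< h (≤-<-trans (n≤tri (r x)) (tri<2^ (r x))))
  ... | k , 1+k≡rx , ru≤k =
    d , d≤n , sameColumn-complete fzero (fsuc fzero) n (d ∷ x ∷ u ∷ []) rd≡rx , onDiagonal ,
    z , ≤-trans (<⇒≤ (⟨⟩<-of-row< ru≤k (subst (k <_) 1+k≡cd (n<1+n k)))) d≤n ,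
    sameColumn-complete fzero (fsuc (fsuc (fsuc fzero))) n (z ∷ d ∷ x ∷ u ∷ []) rz≡ru ,
    nextRow-complete fzero (fsuc fzero) n (z ∷ d ∷ x ∷ u ∷ []) d≤n 1+cz≡cd ,
    subst₂ (λ i j → T (bit i j)) (sym (trans 1+cz≡cd cd≡rx)) (sym rz≡ru) h
    where
    d : ℕ
    d = ⟨ r x , r x ⟩
    d≤n : d ≤ n
    d≤n = ≤-trans (diagonal≤ x) x≤n
    rd≡rx : r d ≡ r x
    rd≡rx = r-⟨⟩ ≤-refl
    cd≡rx : c d ≡ r x
    cd≡rx = c-⟨⟩ ≤-refl
    onDiagonal : ¬ Sat (offDiagonalᶠ fzero) n (d ∷ x ∷ u ∷ [])
    onDiagonal off = <⇒≢ (offDiagonal-sound fzero n (d ∷ x ∷ u ∷ []) d≤n off) (trans rd≡rx (sym cd≡rx))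
    1+k≡cd : suc k ≡ c d
    1+k≡cd = trans 1+k≡rx (sym cd≡rx)
    z : ℕ
    z = ⟨ k , r u ⟩
    rz≡ru : r z ≡ r u
    rz≡ru = r-⟨⟩ ru≤k
    1+cz≡cd : suc (c z) ≡ c d
    1+cz≡cd = trans (cong suc (c-⟨⟩ ru≤k)) 1+k≡cd

⟦⟧≡ : ∀ {k} (φ : Formula k) n ρ {b} → Sat φ n ρ ⇔ T b → ⟦ φ ⟧ n ρ ≡ b
⟦⟧≡ φ n ρ {b} φ⇔b =
  det (Sat-reflects φ n ρ) (map-reflects (Equivalence.from φ⇔b) (Equivalence.to φ⇔b) (T-reflects b))

lemma3p4 : Σ (Formula 2) λ φQ → Σ (Formula 2) λ φR →
    (n x u : ℕ) → x ≤ n → u ≤ n →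
      (⟦ φQ ⟧ n (x ∷ u ∷ []) ≡ bit (q x) (r u))
      × (⟦ φR ⟧ n (x ∷ u ∷ []) ≡ bit (r x) (r u))
lemma3p4 = φQ , φR , λ n x u x≤n u≤n →
  ⟦⟧≡ φQ n (x ∷ u ∷ []) (φQ-sem x≤n u≤n) , ⟦⟧≡ φR n (x ∷ u ∷ []) (φR-sem x≤n u≤n)
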